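{- Let $n\ge 3$, let $a,b,c,e,f,g\in\mathbb{Z}^n$ and $0\neq t\in\mathbb{Z}$ with $e\wedge f\wedge g=t\,(a\wedge b\wedge c)$ and $\gcd(a\wedge b\wedge c)=1$. Let $L\in\mathbb{Z}^{\binom{n}{3}}$ satisfy $L\cdot(a\wedge b\wedge c)=1$, and let $H$ be the $3\times3$ integer matrix $$H=\begin{pmatrix} L\cdot(e\wedge b\wedge c) & L\cdot(f\wedge b\wedge c) & L\cdot(g\wedge b\wedge c)\\ L\cdot(a\wedge e\wedge c) & L\cdot(a\wedge f\wedge c) & L\cdot(a\wedge g\wedge c)\\ L\cdot(a\wedge b\wedge e) & L\cdot(a\wedge b\wedge f) & L\cdot(a\wedge b\wedge g)\end{pmatrix},$$ where $\cdot$ is the standard inner product on $\mathbb{Z}^{\binom n3}$. Then $[a,b,c]H=[e,f,g]$ (as $n\times3$ matrices) and $\det H=t$.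
   Context: For $v_1,v_2,v_3\in\mathbb{Z}^n$, $v_1\wedge v_2\wedge v_3\in\mathbb{Z}^{\binom n3}$ is the vector whose coordinate indexed by $i_1<i_2<i_3$ is the $3\times3$ minor of the $n\times 3$ matrix $[v_1\,v_2\,v_3]$ on rows $i_1,i_2,i_3$. For a vector $Y$, $\gcd(Y)$ denotes the gcd of its coordinates. -}

module Defs where

open import Data.Nat using (ℕ)
open import Data.Integer using (ℤ; _+_; _*_; _-_; ∣_∣; 0ℤ)
import Data.Fin as Fin
open Fin using (Fin; _<_)
open import Data.Fin.Properties using (_<?_)
open import Data.List using (List; []; _∷_; map; concatMap; allFin; filter; foldr; zipWith)
open import Data.Product using (_×_; _,_)
open import Data.Nat.GCD using (gcd)

Vecℤ : ℕ → Set
Vecℤ n = Fin n → ℤ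

det3 : ℤ → ℤ → ℤ → ℤ → ℤ → ℤ → ℤ → ℤ → ℤ → ℤ
det3 a11 a12 a13 a21 a22 a23 a31 a32 a33 =
  a11 * (a22 * a33 - a23 * a32)
  - a12 * (a21 * a33 - a23 * a31)
  + a13 * (a21 * a32 - a22 * a31)

-- index set {(i₁,i₂,i₃) : i₁ < i₂ < i₃}, in lexicographic order
Triple : ℕ → Set
Triple n = Fin n × Fin n × Fin n

triples : (n : ℕ) → List (Triple n)
triples n =
  concatMap (λ i → concatMap (λ j → map (λ k → (i , j , k))
     (filter (λ k → j <? k) (allFin n)))
     (filter (λ j → i <? j) (allFin n)))
  (allFin n)

minor : ∀ {n} → Vecℤ n → Vecℤ n → Vecℤ n → Triple n → ℤ
minor u v w (i , j , k) =
  det3 (u i) (v i) (w i) (u j) (v j) (w j) (u k) (v k) (w k)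

wedge : ∀ {n} → Vecℤ n → Vecℤ n → Vecℤ n → List ℤ
wedge {n} u v w = map (minor u v w) (triples n)

-- gcd of the coordinates of a vector (gcd of the empty vector is 0)
gcdList : List ℤ → ℕ
gcdList = foldr (λ x r → gcd ∣ x ∣ r) 0

dot : List ℤ → List ℤ → ℤ
dot xs ys = foldr _+_ 0ℤ (zipWith _*_ xs ys)

scale : ℤ → List ℤ → List ℤ
scale t = map (t *_)

Hmat : ∀ {n} → List ℤ → (a b c e f g : Vecℤ n) → Fin 3 → Fin 3 → ℤ
Hmat L a b c e f g r s = dot L (row r (col s))
  where
  col : Fin 3 → Vecℤ _
  col Fin.zero = e
  col (Fin.suc Fin.zero) = f
  col (Fin.suc (Fin.suc Fin.zero)) = g
  row : Fin 3 → Vecℤ _ → List ℤ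
  row Fin.zero x = wedge x b c
  row (Fin.suc Fin.zero) x = wedge a x c
  row (Fin.suc (Fin.suc Fin.zero)) x = wedge a b x

detM : (Fin 3 → Fin 3 → ℤ) → ℤ
detM M = det3 (M 0F 0F) (M 0F 1F) (M 0F 2F) (M 1F 0F) (M 1F 1F) (M 1F 2F) (M 2F 0F) (M 2F 1F) (M 2F 2F)
  where
  0F 1F 2F : Fin 3
  0F = Fin.zero
  1F = Fin.suc Fin.zero
  2F = Fin.suc (Fin.suc Fin.zero)

mat3 : ∀ {n} → (u v w : Vecℤ n) → Fin n → Fin 3 → ℤ
mat3 u v w i Fin.zero = u i
mat3 u v w i (Fin.suc Fin.zero) = v i
mat3 u v w i (Fin.suc (Fin.suc Fin.zero)) = w i

mul3 : ∀ {n} → (Fin n → Fin 3 → ℤ) → (Fin 3 → Fin 3 → ℤ) → Fin n → Fin 3 → ℤ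
mul3 A M i s = A i Fin.zero * M Fin.zero s + A i (Fin.suc Fin.zero) * M (Fin.suc Fin.zero) s
  + A i (Fin.suc (Fin.suc Fin.zero)) * M (Fin.suc (Fin.suc Fin.zero)) s

-- Write m_T(x, y, z) for the minor of [x y z] on the rows T.  For x among e, f, g the
-- 4 × 4 minors of [x e f g] vanish; since every 3 × 3 minor of [e f g] is t times the
-- corresponding one of [a b c] and t ≠ 0, so do the 4 × 4 minors of [x a b c] — first on
-- increasing rows, the only ones the wedge records, and then, by alternation, on all rows
-- (i, T) with T increasing.  Expanding such a vanishing minor along the row i gives
--   x_i m_T(a, b, c) = a_i m_T(x, b, c) + b_i m_T(a, x, c) + c_i m_T(a, b, x),
-- and pairing with L, which pairs a ∧ b ∧ c to 1, turns this into x = [a b c] H, column by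
-- column.  Then e ∧ f ∧ g = det H · (a ∧ b ∧ c) by Cauchy–Binet, and pairing with L once more
-- gives det H = t.

module Submission where

open import Defs
open import Data.Nat using (ℕ; _≥_)
open import Data.Nat.Combinatorics using (_C_)
open import Data.Integer using (ℤ; 0ℤ; 1ℤ)
open import Data.Fin using (Fin)
open import Data.List using (List; length)
open import Data.Product using (_×_)
open import Relation.Binary.PropositionalEquality using (_≡_; _≢_)

open import Data.Integer using (_+_; _*_; _-_; -_; ≢-nonZero)
open import Data.Integer.Properties using (+-identityʳ; *-identityʳ; *-zeroʳ; *-cancelˡ-≡)
open import Data.Integer.Solver using (module +-*-Solver)
open import Data.Fin using (zero; suc; _<_)
open import Data.Fin.Properties using (<-cmp; _<?_; <-trans)
open import Relation.Binary.Definitions using (tri<; tri≈; tri>)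
open import Data.List using ([]; _∷_; map; allFin; filter)
open import Data.List.Properties using (∷-injective; map-∘; map-cong; map-cong-local)
open import Data.List.Relation.Unary.All using (tabulate)
open import Data.List.Relation.Unary.Any using (here; there)
open import Data.List.Membership.Propositional using (_∈_; find; lose)
open import Data.List.Membership.Propositional.Properties
  using (∈-concatMap⁺; ∈-concatMap⁻; ∈-filter⁺; ∈-filter⁻; ∈-allFin; ∈-map⁺; ∈-map⁻)
open import Data.Product using (_,_; proj₁; proj₂)
open import Relation.Binary.PropositionalEquality using (refl; sym; trans; cong; module ≡-Reasoning)

open +-*-Solver using (Polynomial; con; _:+_; _:*_; _:-_; :-_; _:=_; solve)

-- The interpretation of det3ᵉ unfolds definitionally to det3, so identities proved by
-- 'solve' on these expressions can be stated directly in terms of det3 and minor.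
det3ᵉ : ∀ {m} → (_ _ _ _ _ _ _ _ _ : Polynomial m) → Polynomial m
det3ᵉ a₁₁ a₁₂ a₁₃ a₂₁ a₂₂ a₂₃ a₃₁ a₃₂ a₃₃ =
  a₁₁ :* (a₂₂ :* a₃₃ :- a₂₃ :* a₃₂)
  :- a₁₂ :* (a₂₁ :* a₃₃ :- a₂₃ :* a₃₁)
  :+ a₁₃ :* (a₂₁ :* a₃₂ :- a₂₂ :* a₃₁)

det4ᵉ : ∀ {m} → (_ _ _ _ _ _ _ _ _ _ _ _ _ _ _ _ : Polynomial m) → Polynomial m
det4ᵉ xi ai bi ci xj aj bj cj xk ak bk ck xl al bl cl =
  xi :* det3ᵉ aj bj cj ak bk ck al bl cl :- xj :* det3ᵉ ai bi ci ak bk ck al bl cl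
  :+ xk :* det3ᵉ ai bi ci aj bj cj al bl cl :- xl :* det3ᵉ ai bi ci aj bj cj ak bk ck

det3-cong : ∀ {a₁ a₂ a₃ a₄ a₅ a₆ a₇ a₈ a₉ b₁ b₂ b₃ b₄ b₅ b₆ b₇ b₈ b₉ : ℤ} →
  a₁ ≡ b₁ → a₂ ≡ b₂ → a₃ ≡ b₃ → a₄ ≡ b₄ → a₅ ≡ b₅ → a₆ ≡ b₆ → a₇ ≡ b₇ → a₈ ≡ b₈ → a₉ ≡ b₉ →
  det3 a₁ a₂ a₃ a₄ a₅ a₆ a₇ a₈ a₉ ≡ det3 b₁ b₂ b₃ b₄ b₅ b₆ b₇ b₈ b₉
det3-cong refl refl refl refl refl refl refl refl refl = refl

∈-triples⁺ : ∀ {n} {i j k : Fin n} → i < j → j < k → (i , j , k) ∈ triples n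
∈-triples⁺ {i = i} {j} {k} i<j j<k =
  ∈-concatMap⁺ _ (lose (∈-allFin i)
    (∈-concatMap⁺ _ (lose (∈-filter⁺ (i <?_) (∈-allFin j) i<j)
      (∈-map⁺ (λ k → i , j , k) (∈-filter⁺ (j <?_) (∈-allFin k) j<k)))))

∈-triples⁻ : ∀ {n} {i j k : Fin n} → (i , j , k) ∈ triples n → i < j × j < k
∈-triples⁻ {n} T∈ with find (∈-concatMap⁻ _ {xs = allFin n} T∈)
... | i , _ , T∈ᵢ with find (∈-concatMap⁻ _ {xs = filter (i <?_) (allFin n)} T∈ᵢ)
... | j , j∈ , T∈ᵢⱼ with ∈-map⁻ (λ k → i , j , k) {xs = filter (j <?_) (allFin n)} T∈ᵢⱼ
... | k , k∈ , refl = proj₂ (∈-filter⁻ (i <?_) {xs = allFin n} j∈) , proj₂ (∈-filter⁻ (j <?_) {xs = allFin n} k∈)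

map-≡⇒∈-≡ : ∀ {A B : Set} {f g : A → B} xs → map f xs ≡ map g xs →
  ∀ {x} → x ∈ xs → f x ≡ g x
map-≡⇒∈-≡ (_ ∷ _)  eq (here refl) = proj₁ (∷-injective eq)
map-≡⇒∈-≡ (_ ∷ xs) eq (there x∈)  = map-≡⇒∈-≡ xs (proj₂ (∷-injective eq)) x∈

dot-scale : ∀ L d xs → dot L (scale d xs) ≡ d * dot L xs
dot-scale []      d xs       = sym (*-zeroʳ d)
dot-scale (_ ∷ _) d []       = sym (*-zeroʳ d)
dot-scale (l ∷ L) d (x ∷ xs) = trans (cong (l * (d * x) +_) (dot-scale L d xs)) (distrib l d x _)
  where
  distrib : ∀ l d x r → l * (d * x) + d * r ≡ d * (l * x + r)
  distrib = solve 4 (λ l d x r → l :* (d :* x) :+ d :* r := d :* (l :* x :+ r)) refl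

dot-map-* : ∀ {A : Set} L (F : A → ℤ) d xs → dot L (map (λ x → d * F x) xs) ≡ d * dot L (map F xs)
dot-map-* L F d xs = trans (cong (dot L) (map-∘ xs)) (dot-scale L d (map F xs))

dot-map-+ : ∀ {A : Set} L (F G : A → ℤ) xs →
  dot L (map (λ x → F x + G x) xs) ≡ dot L (map F xs) + dot L (map G xs)
dot-map-+ []      F G xs       = refl
dot-map-+ (_ ∷ _) F G []       = refl
dot-map-+ (l ∷ L) F G (x ∷ xs) =
  trans (cong (l * (F x + G x) +_) (dot-map-+ L F G xs)) (distrib l (F x) (G x) _ _)
  where
  distrib : ∀ l u v r s → l * (u + v) + (r + s) ≡ (l * u + r) + (l * v + s)
  distrib = solve 5 (λ l u v r s → l :* (u :+ v) :+ (r :+ s) := (l :* u :+ r) :+ (l :* v :+ s)) refl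

dot≡1⇒scale-injective : ∀ L xs → dot L xs ≡ 1ℤ → ∀ {s s′} → scale s xs ≡ scale s′ xs → s ≡ s′
dot≡1⇒scale-injective L xs L·xs≡1 {s} {s′} eq = begin
  s               ≡⟨ sym (*-identityʳ s) ⟩
  s * 1ℤ          ≡⟨ cong (s *_) (sym L·xs≡1) ⟩
  s * dot L xs    ≡⟨ sym (dot-scale L s xs) ⟩
  dot L (scale s xs)  ≡⟨ cong (dot L) eq ⟩
  dot L (scale s′ xs) ≡⟨ dot-scale L s′ xs ⟩
  s′ * dot L xs   ≡⟨ cong (s′ *_) L·xs≡1 ⟩
  s′ * 1ℤ         ≡⟨ *-identityʳ s′ ⟩
  s′              ∎
  where open ≡-Reasoning

Indexed₄ : ℕ → Set
Indexed₄ n = Fin n → Fin n → Fin n → Fin n → ℤ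

-- The minor of [x a b c] on the rows i, j, k, l (in this order), expanded along x.
det4 : ∀ {n} → (x a b c : Vecℤ n) → Indexed₄ n
det4 x a b c i j k l = x i * minor a b c (j , k , l) - x j * minor a b c (i , k , l)
  + x k * minor a b c (i , j , l) - x l * minor a b c (i , j , k)

record Alternating {n} (D : Indexed₄ n) : Set where
  field
    swap₁₂ : ∀ i j k l → D i j k l ≡ - D j i k l
    swap₂₃ : ∀ i j k l → D i j k l ≡ - D i k j l
    swap₃₄ : ∀ i j k l → D i j k l ≡ - D i j l k
    diag₁₂ : ∀ i k l → D i i k l ≡ 0ℤ

VanishesOnIncreasing : ∀ {n} → Indexed₄ n → Set
VanishesOnIncreasing D = ∀ {i j k l} → i < j → j < k → k < l → D i j k l ≡ 0ℤ

module _ {n} {D : Indexed₄ n} (alt : Alternating D) (increasing-zero : VanishesOnIncreasing D) where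
  open Alternating alt

  private
    zero-of-neg : ∀ {u v} → u ≡ - v → v ≡ 0ℤ → u ≡ 0ℤ
    zero-of-neg u≡-v refl = u≡-v

  vanishes-on-increasing-tails : ∀ i {j k l} → j < k → k < l → D i j k l ≡ 0ℤ
  vanishes-on-increasing-tails i {j} {k} {l} j<k k<l with <-cmp i j
  ... | tri< i<j _ _ = increasing-zero i<j j<k k<l
  ... | tri≈ _ refl _ = diag₁₂ i k l
  ... | tri> _ _ j<i with <-cmp i k
  ... | tri< i<k _ _ = zero-of-neg (swap₁₂ i j k l) (increasing-zero j<i i<k k<l)
  ... | tri≈ _ refl _ = zero-of-neg (swap₂₃ i j i l) (diag₁₂ i j l)
  ... | tri> _ _ k<i with <-cmp i l
  ... | tri< i<l _ _ = zero-of-neg (swap₁₂ i j k l) (zero-of-neg (swap₂₃ j i k l) (increasing-zero j<k k<i i<l))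
  ... | tri≈ _ refl _ = zero-of-neg (swap₃₄ i j k i) (zero-of-neg (swap₂₃ i j i k) (diag₁₂ i j k))
  ... | tri> _ _ l<i = zero-of-neg (swap₁₂ i j k l)
          (zero-of-neg (swap₂₃ j i k l) (zero-of-neg (swap₃₄ j k i l) (increasing-zero j<k k<l l<i)))

module _ {n} (x a b c : Vecℤ n) where

  det4-alternating : Alternating (det4 x a b c)
  det4-alternating = record
    { swap₁₂ = λ i j k l → solve 16
        (λ xi ai bi ci xj aj bj cj xk ak bk ck xl al bl cl →
          det4ᵉ xi ai bi ci xj aj bj cj xk ak bk ck xl al bl cl
            := :- det4ᵉ xj aj bj cj xi ai bi ci xk ak bk ck xl al bl cl)
        refl (x i) (a i) (b i) (c i) (x j) (a j) (b j) (c j) (x k) (a k) (b k) (c k) (x l) (a l) (b l) (c l)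
    ; swap₂₃ = λ i j k l → solve 16
        (λ xi ai bi ci xj aj bj cj xk ak bk ck xl al bl cl →
          det4ᵉ xi ai bi ci xj aj bj cj xk ak bk ck xl al bl cl
            := :- det4ᵉ xi ai bi ci xk ak bk ck xj aj bj cj xl al bl cl)
        refl (x i) (a i) (b i) (c i) (x j) (a j) (b j) (c j) (x k) (a k) (b k) (c k) (x l) (a l) (b l) (c l)
    ; swap₃₄ = λ i j k l → solve 16
        (λ xi ai bi ci xj aj bj cj xk ak bk ck xl al bl cl →
          det4ᵉ xi ai bi ci xj aj bj cj xk ak bk ck xl al bl cl
            := :- det4ᵉ xi ai bi ci xj aj bj cj xl al bl cl xk ak bk ck)
        refl (x i) (a i) (b i) (c i) (x j) (a j) (b j) (c j) (x k) (a k) (b k) (c k) (x l) (a l) (b l) (c l)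
    ; diag₁₂ = λ i k l → solve 12
        (λ xi ai bi ci xk ak bk ck xl al bl cl →
          det4ᵉ xi ai bi ci xi ai bi ci xk ak bk ck xl al bl cl := con 0ℤ)
        refl (x i) (a i) (b i) (c i) (x k) (a k) (b k) (c k) (x l) (a l) (b l) (c l)
    }

  det4-laplace-row₁ : ∀ i j k l → x i * minor a b c (j , k , l)
    ≡ a i * minor x b c (j , k , l) + b i * minor a x c (j , k , l) + c i * minor a b x (j , k , l)
      + det4 x a b c i j k l
  det4-laplace-row₁ i j k l = solve 16
    (λ xi ai bi ci xj aj bj cj xk ak bk ck xl al bl cl →
      xi :* det3ᵉ aj bj cj ak bk ck al bl cl
        := ai :* det3ᵉ xj bj cj xk bk ck xl bl cl :+ bi :* det3ᵉ aj xj cj ak xk ck al xl cl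
           :+ ci :* det3ᵉ aj bj xj ak bk xk al bl xl
           :+ det4ᵉ xi ai bi ci xj aj bj cj xk ak bk ck xl al bl cl)
    refl (x i) (a i) (b i) (c i) (x j) (a j) (b j) (c j) (x k) (a k) (b k) (c k) (x l) (a l) (b l) (c l)

module _ {n} (a b c : Vecℤ n) where

  det4-repeat₁ : ∀ i j k l → det4 a a b c i j k l ≡ 0ℤ
  det4-repeat₁ i j k l = solve 12
    (λ ai bi ci aj bj cj ak bk ck al bl cl →
      det4ᵉ ai ai bi ci aj aj bj cj ak ak bk ck al al bl cl := con 0ℤ)
    refl (a i) (b i) (c i) (a j) (b j) (c j) (a k) (b k) (c k) (a l) (b l) (c l)

  det4-repeat₂ : ∀ i j k l → det4 b a b c i j k l ≡ 0ℤ
  det4-repeat₂ i j k l = solve 12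
    (λ ai bi ci aj bj cj ak bk ck al bl cl →
      det4ᵉ bi ai bi ci bj aj bj cj bk ak bk ck bl al bl cl := con 0ℤ)
    refl (a i) (b i) (c i) (a j) (b j) (c j) (a k) (b k) (c k) (a l) (b l) (c l)

  det4-repeat₃ : ∀ i j k l → det4 c a b c i j k l ≡ 0ℤ
  det4-repeat₃ i j k l = solve 12
    (λ ai bi ci aj bj cj ak bk ck al bl cl →
      det4ᵉ ci ai bi ci cj aj bj cj ck ak bk ck cl al bl cl := con 0ℤ)
    refl (a i) (b i) (c i) (a j) (b j) (c j) (a k) (b k) (c k) (a l) (b l) (c l)

module _ {n} (a b c e f g : Vecℤ n) {t : ℤ} (efg≡t·abc : wedge e f g ≡ scale t (wedge a b c)) where

  private
    minors≡ : ∀ {T} → T ∈ triples n → minor e f g T ≡ t * minor a b c T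
    minors≡ = map-≡⇒∈-≡ {f = minor e f g} {g = λ T → t * minor a b c T} (triples n)
      (trans efg≡t·abc (sym (map-∘ {g = t *_} {f = minor a b c} (triples n))))

  det4-scaled : ∀ x {i j k l} → i < j → j < k → k < l →
    det4 x e f g i j k l ≡ t * det4 x a b c i j k l
  det4-scaled x {i} {j} {k} {l} i<j j<k k<l = begin
    det4 x e f g i j k l
      ≡⟨ cong₄ (λ u v w z → x i * u - x j * v + x k * w - x l * z)
           (minors≡ (∈-triples⁺ j<k k<l)) (minors≡ (∈-triples⁺ (<-trans i<j j<k) k<l))
           (minors≡ (∈-triples⁺ i<j (<-trans j<k k<l))) (minors≡ (∈-triples⁺ i<j j<k)) ⟩
    x i * (t * m₁) - x j * (t * m₂) + x k * (t * m₃) - x l * (t * m₄)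
      ≡⟨ factor (x i) (x j) (x k) (x l) m₁ m₂ m₃ m₄ t ⟩
    t * det4 x a b c i j k l ∎
    where
    open ≡-Reasoning
    m₁ = minor a b c (j , k , l)
    m₂ = minor a b c (i , k , l)
    m₃ = minor a b c (i , j , l)
    m₄ = minor a b c (i , j , k)
    cong₄ : ∀ (h : ℤ → ℤ → ℤ → ℤ → ℤ) {u u′ v v′ w w′ z z′} →
      u ≡ u′ → v ≡ v′ → w ≡ w′ → z ≡ z′ → h u v w z ≡ h u′ v′ w′ z′
    cong₄ h refl refl refl refl = refl
    factor : ∀ xi xj xk xl m₁ m₂ m₃ m₄ t →
      xi * (t * m₁) - xj * (t * m₂) + xk * (t * m₃) - xl * (t * m₄)
        ≡ t * (xi * m₁ - xj * m₂ + xk * m₃ - xl * m₄)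
    factor = solve 9 (λ xi xj xk xl m₁ m₂ m₃ m₄ t →
      xi :* (t :* m₁) :- xj :* (t :* m₂) :+ xk :* (t :* m₃) :- xl :* (t :* m₄)
        := t :* (xi :* m₁ :- xj :* m₂ :+ xk :* m₃ :- xl :* m₄)) refl

  det4-vanishes-transfer : t ≢ 0ℤ → ∀ x → (∀ i j k l → det4 x e f g i j k l ≡ 0ℤ) →
    VanishesOnIncreasing (det4 x a b c)
  det4-vanishes-transfer t≢0 x zero-efg {i} {j} {k} {l} i<j j<k k<l =
    *-cancelˡ-≡ t _ 0ℤ {{≢-nonZero t≢0}}
      (trans (sym (det4-scaled x i<j j<k k<l)) (trans (zero-efg i j k l) (sym (*-zeroʳ t))))

cramer : ∀ {n} L (x a b c : Vecℤ n) → dot L (wedge a b c) ≡ 1ℤ →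
  ∀ i → (∀ {j k l} → j < k → k < l → det4 x a b c i j k l ≡ 0ℤ) →
  a i * dot L (wedge x b c) + b i * dot L (wedge a x c) + c i * dot L (wedge a b x) ≡ x i
cramer {n} L x a b c L·abc≡1 i zero-at-i = sym (begin
  x i                                   ≡⟨ sym (*-identityʳ (x i)) ⟩
  x i * 1ℤ                              ≡⟨ cong (x i *_) (sym L·abc≡1) ⟩
  x i * dot L (wedge a b c)             ≡⟨ sym (dot-map-* L (minor a b c) (x i) Ts) ⟩
  dot L (map (λ T → x i * minor a b c T) Ts)
    ≡⟨ cong (dot L) (map-cong-local (tabulate expand)) ⟩
  dot L (map (λ T → P T + Q T + R T) Ts)
    ≡⟨ dot-map-+ L (λ T → P T + Q T) R Ts ⟩
  dot L (map (λ T → P T + Q T) Ts) + dot L (map R Ts)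
    ≡⟨ cong (_+ dot L (map R Ts)) (dot-map-+ L P Q Ts) ⟩
  dot L (map P Ts) + dot L (map Q Ts) + dot L (map R Ts)
    ≡⟨ cong₃ (λ u v w → u + v + w) (dot-map-* L (minor x b c) (a i) Ts)
         (dot-map-* L (minor a x c) (b i) Ts) (dot-map-* L (minor a b x) (c i) Ts) ⟩
  a i * dot L (wedge x b c) + b i * dot L (wedge a x c) + c i * dot L (wedge a b x) ∎)
  where
  open ≡-Reasoning
  Ts = triples n
  P Q R : Triple n → ℤ
  P T = a i * minor x b c T
  Q T = b i * minor a x c T
  R T = c i * minor a b x T
  cong₃ : ∀ (h : ℤ → ℤ → ℤ → ℤ) {u u′ v v′ w w′} → u ≡ u′ → v ≡ v′ → w ≡ w′ → h u v w ≡ h u′ v′ w′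
  cong₃ h refl refl refl = refl
  expand : ∀ {T} → T ∈ Ts → x i * minor a b c T ≡ P T + Q T + R T
  expand {j , k , l} T∈ with ∈-triples⁻ T∈
  ... | j<k , k<l = begin
    x i * minor a b c T                ≡⟨ det4-laplace-row₁ x a b c i j k l ⟩
    PQR + det4 x a b c i j k l         ≡⟨ cong (PQR +_) (zero-at-i j<k k<l) ⟩
    PQR + 0ℤ                           ≡⟨ +-identityʳ PQR ⟩
    PQR                                ∎
    where
    T = (j , k , l)
    PQR = P T + Q T + R T

wedge-mul : ∀ {n} (a b c e f g : Vecℤ n) (H : Fin 3 → Fin 3 → ℤ) →
  (∀ i s → mul3 (mat3 a b c) H i s ≡ mat3 e f g i s) →
  wedge e f g ≡ scale (detM H) (wedge a b c)
wedge-mul {n} a b c e f g H [abc]H≡efg =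
  trans (map-cong minor≡ (triples n)) (map-∘ {g = detM H *_} {f = minor a b c} (triples n))
  where
  0F 1F 2F : Fin 3
  0F = zero
  1F = suc zero
  2F = suc (suc zero)
  minor≡ : ∀ T → minor e f g T ≡ detM H * minor a b c T
  minor≡ (j , k , l) = trans
    (det3-cong (sym ([abc]H≡efg j 0F)) (sym ([abc]H≡efg j 1F)) (sym ([abc]H≡efg j 2F))
               (sym ([abc]H≡efg k 0F)) (sym ([abc]H≡efg k 1F)) (sym ([abc]H≡efg k 2F))
               (sym ([abc]H≡efg l 0F)) (sym ([abc]H≡efg l 1F)) (sym ([abc]H≡efg l 2F)))
    (solve 18
      (λ aj bj cj ak bk ck al bl cl h₀₀ h₀₁ h₀₂ h₁₀ h₁₁ h₁₂ h₂₀ h₂₁ h₂₂ →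
        det3ᵉ (aj :* h₀₀ :+ bj :* h₁₀ :+ cj :* h₂₀) (aj :* h₀₁ :+ bj :* h₁₁ :+ cj :* h₂₁)
              (aj :* h₀₂ :+ bj :* h₁₂ :+ cj :* h₂₂)
              (ak :* h₀₀ :+ bk :* h₁₀ :+ ck :* h₂₀) (ak :* h₀₁ :+ bk :* h₁₁ :+ ck :* h₂₁)
              (ak :* h₀₂ :+ bk :* h₁₂ :+ ck :* h₂₂)
              (al :* h₀₀ :+ bl :* h₁₀ :+ cl :* h₂₀) (al :* h₀₁ :+ bl :* h₁₁ :+ cl :* h₂₁)
              (al :* h₀₂ :+ bl :* h₁₂ :+ cl :* h₂₂)
          := det3ᵉ h₀₀ h₀₁ h₀₂ h₁₀ h₁₁ h₁₂ h₂₀ h₂₁ h₂₂ :* det3ᵉ aj bj cj ak bk ck al bl cl)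
      refl (a j) (b j) (c j) (a k) (b k) (c k) (a l) (b l) (c l)
           (H 0F 0F) (H 0F 1F) (H 0F 2F) (H 1F 0F) (H 1F 1F) (H 1F 2F) (H 2F 0F) (H 2F 1F) (H 2F 2F))

lemma3p4 : (n : ℕ) → n ≥ 3 → (a b c e f g : Vecℤ n) → (t : ℤ) → t ≢ 0ℤ →
    wedge e f g ≡ scale t (wedge a b c) →
    gcdList (wedge a b c) ≡ 1 →
    (L : List ℤ) → length L ≡ n C 3 →
    dot L (wedge a b c) ≡ 1ℤ →
    ((i : Fin n) → (s : Fin 3) →
       mul3 (mat3 a b c) (Hmat L a b c e f g) i s ≡ mat3 e f g i s)
    × detM (Hmat L a b c e f g) ≡ t
lemma3p4 n _ a b c e f g t t≢0 efg≡t·abc _ L _ L·abc≡1 = [abc]H≡efg , detH≡t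
  where
  H = Hmat L a b c e f g
  column : ∀ x → (∀ i j k l → det4 x e f g i j k l ≡ 0ℤ) → ∀ i →
    a i * dot L (wedge x b c) + b i * dot L (wedge a x c) + c i * dot L (wedge a b x) ≡ x i
  column x zero-efg i = cramer L x a b c L·abc≡1 i
    (vanishes-on-increasing-tails (det4-alternating x a b c)
      (det4-vanishes-transfer a b c e f g efg≡t·abc t≢0 x zero-efg) i)
  [abc]H≡efg : ∀ i s → mul3 (mat3 a b c) H i s ≡ mat3 e f g i s
  [abc]H≡efg i zero             = column e (det4-repeat₁ e f g) i
  [abc]H≡efg i (suc zero)       = column f (det4-repeat₂ e f g) i
  [abc]H≡efg i (suc (suc zero)) = column g (det4-repeat₃ e f g) i
  detH≡t : detM H ≡ t
  detH≡t = dot≡1⇒scale-injective L (wedge a b c) L·abc≡1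
    (trans (sym (wedge-mul a b c e f g H [abc]H≡efg)) efg≡t·abc)
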